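{- As $n\to\infty$, $|S_{9,0}(n)|=O(n^{\ln 3/\ln 4})=O(n^{0.79248\ldots})$.
   Context: For an integer $k\ge 0$ let $\sigma(k)$ be the sum of its binary digits. For $x\in\mathbb{N}$ define $S_{9,0}(x)=\sum_{0\le k<x,\ 9\mid k}(-1)^{\sigma(k)}$. -}

module Defs where

open import Data.Nat using (ℕ; zero; suc; _+_; _%_; _/_)
open import Data.Nat.Divisibility using (_∣?_)
open import Data.Integer using (ℤ; +_; -_)
import Data.Integer as ℤ
open import Relation.Nullary.Decidable using (does)
open import Data.Bool using (if_then_else_)

-- binary digit sum with fuel; fuel m ≥ number of binary digits of m
bitsumFuel : ℕ → ℕ → ℕ
bitsumFuel zero    _ = 0
bitsumFuel (suc f) m = m % 2 + bitsumFuel f (m / 2)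

σ : ℕ → ℕ
σ k = bitsumFuel k k

sgn : ℕ → ℤ
sgn k = if does (σ k % 2 Data.Nat.≟ 0) then + 1 else - (+ 1)

S90 : ℕ → ℤ
S90 zero    = + 0
S90 (suc x) = S90 x ℤ.+ (if does (9 ∣? x) then sgn x else + 0)

-- Write t(k) = (-1)^σ(k) and S_d(n) = Σ_{k<n, d∣k} t(k).  Since σ(e + m·2^j) = σ(e) + σ(m)
-- for e < 2^j, splitting [0, q·2^j) into blocks of length 2^j turns S_d(q·2^j) into a
-- sum over m < q of t(m) times a weight that only depends on m mod d, provided
-- 2^j ≡ 1 (mod d).  For (d, 2^j) = (9, 64), (3, 4), (1, 2) a finite computation gives
--   S₉(64q) = 3 S₉(q) + 8 S₃(q) − 3 S₁(q),   S₃(4q) = 3 S₃(q) − S₁(q),   S₁(2q) = 0.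
-- Hence |S₁| ≤ 1, |S₃(n)| = O(3^k) for n < 4^k, and then |S₉(n)| = O(3^k) for n < 4^k,
-- the incomplete last block contributing only a bounded error at each step.
{-# OPTIONS --safe #-}
module Submission where

open import Defs
open import Data.Nat using (ℕ; _≤_; _<_; _*_; _^_; zero; suc; _+_; _%_; _/_; z≤n; s≤s; NonZero; _≟_)
open import Data.Integer using (∣_∣)
open import Data.Product using (∃; _,_)
open import Data.Nat.Properties
open import Data.Nat.DivMod
open import Data.Nat.Divisibility using (_∣_; _∣?_; divides; ∣-refl; 1∣_)
open import Data.Nat.Tactic.RingSolver using (solve-∀)
open import Data.Integer as ℤ using (ℤ; +_; -_; -1ℤ)
import Data.Integer.Properties as ℤ
import Data.Integer.Tactic.RingSolver as ℤ-Solver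
open import Data.Bool using (true; false; if_then_else_)
open import Relation.Nullary.Decidable using (does; True; toWitness)
open import Relation.Binary.PropositionalEquality

-- Binary digit sums

bitsumFuel-0 : ∀ f → bitsumFuel f 0 ≡ 0
bitsumFuel-0 zero    = refl
bitsumFuel-0 (suc f) = bitsumFuel-0 f

m≤1+n⇒m/2≤n : ∀ m n → m ≤ suc n → m / 2 ≤ n
m≤1+n⇒m/2≤n zero       n _   = z≤n
m≤1+n⇒m/2≤n m@(suc _) n m≤ = ≤-pred (≤-trans (m/n<m m 2 (s≤s (s≤s z≤n))) m≤)

bitsumFuel-irrelevant : ∀ f g m → m ≤ f → m ≤ g → bitsumFuel f m ≡ bitsumFuel g m
bitsumFuel-irrelevant zero    zero    m    _   _   = refl
bitsumFuel-irrelevant zero    (suc g) zero _   _   = sym (bitsumFuel-0 g)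
bitsumFuel-irrelevant (suc f) zero    zero _   _   = bitsumFuel-0 f
bitsumFuel-irrelevant (suc f) (suc g) m    m≤f m≤g =
  cong (λ s → m % 2 + s) (bitsumFuel-irrelevant f g (m / 2) (m≤1+n⇒m/2≤n m f m≤f) (m≤1+n⇒m/2≤n m g m≤g))

σ≡bitsumFuel : ∀ f k → k ≤ f → σ k ≡ bitsumFuel f k
σ≡bitsumFuel f k = bitsumFuel-irrelevant k f k ≤-refl

σ-bit : ∀ b x → b < 2 → σ (b + x * 2) ≡ b + σ x
σ-bit b x b<2 = begin
  σ (b + x * 2)                                       ≡⟨ σ≡bitsumFuel (suc (x * 2)) _ (+-monoˡ-≤ (x * 2) (≤-pred b<2)) ⟩
  (b + x * 2) % 2 + bitsumFuel (x * 2) ((b + x * 2) / 2) ≡⟨ cong₂ (λ r h → r + bitsumFuel (x * 2) h) low high ⟩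
  b + bitsumFuel (x * 2) x                            ≡⟨ cong (λ s → b + s) (σ≡bitsumFuel (x * 2) x (m≤m*n x 2)) ⟨
  b + σ x                                             ∎
  where
  open ≡-Reasoning
  low : (b + x * 2) % 2 ≡ b
  low = trans ([m+kn]%n≡m%n b x 2) (m<n⇒m%n≡m b<2)
  high : (b + x * 2) / 2 ≡ x
  high = begin
    (b + x * 2) / 2     ≡⟨ +-distrib-/-∣ʳ b (divides x refl) ⟩
    b / 2 + x * 2 / 2   ≡⟨ cong₂ _+_ (m<n⇒m/n≡0 b<2) (m*n/n≡m x 2) ⟩
    x                   ∎

σ-+-*2^ : ∀ j e m → e < 2 ^ j → σ (e + m * 2 ^ j) ≡ σ e + σ m
σ-+-*2^ zero    zero    m _         = cong σ (*-identityʳ m)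
σ-+-*2^ zero    (suc e) m (s≤s ())
σ-+-*2^ (suc j) e       m e<2^[1+j] = begin
  σ (e + m * 2 ^ suc j)              ≡⟨ cong σ split ⟩
  σ (e % 2 + (e / 2 + m * 2 ^ j) * 2) ≡⟨ σ-bit (e % 2) (e / 2 + m * 2 ^ j) (m%n<n e 2) ⟩
  e % 2 + σ (e / 2 + m * 2 ^ j)      ≡⟨ cong (λ s → e % 2 + s) (σ-+-*2^ j (e / 2) m e/2<2^j) ⟩
  e % 2 + (σ (e / 2) + σ m)          ≡⟨ +-assoc (e % 2) _ _ ⟨
  e % 2 + σ (e / 2) + σ m            ≡⟨ cong (_+ σ m) (σ-bit (e % 2) (e / 2) (m%n<n e 2)) ⟨
  σ (e % 2 + e / 2 * 2) + σ m        ≡⟨ cong (λ x → σ x + σ m) (m≡m%n+[m/n]*n e 2) ⟨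
  σ e + σ m                          ∎
  where
  open ≡-Reasoning
  e/2<2^j : e / 2 < 2 ^ j
  e/2<2^j = m<n*o⇒m/o<n (subst (e <_) (*-comm 2 (2 ^ j)) e<2^[1+j])
  regroup : ∀ r h m p → r + h * 2 + m * (2 * p) ≡ r + (h + m * p) * 2
  regroup = solve-∀
  split : e + m * 2 ^ suc j ≡ e % 2 + (e / 2 + m * 2 ^ j) * 2
  split = trans (cong (_+ m * 2 ^ suc j) (m≡m%n+[m/n]*n e 2)) (regroup (e % 2) (e / 2) m (2 ^ j))

sgn-parity : ∀ s → (if does (s % 2 ≟ 0) then + 1 else - (+ 1)) ≡ -1ℤ ℤ.^ s
sgn-parity 0             = refl
sgn-parity 1             = refl
sgn-parity (suc (suc s)) = begin
  (if does (suc (suc s) % 2 ≟ 0) then + 1 else - (+ 1)) ≡⟨ cong (λ r → if does (r ≟ 0) then + 1 else - (+ 1)) s+2%2≡s%2 ⟩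
  (if does (s % 2 ≟ 0) then + 1 else - (+ 1))           ≡⟨ sgn-parity s ⟩
  -1ℤ ℤ.^ s                                             ≡⟨ square-cancel (-1ℤ ℤ.^ s) ⟨
  -1ℤ ℤ.^ suc (suc s)                                   ∎
  where
  open ≡-Reasoning
  s+2%2≡s%2 : suc (suc s) % 2 ≡ s % 2
  s+2%2≡s%2 = trans (cong (_% 2) (+-comm 2 s)) ([m+n]%n≡m%n s 2)
  square-cancel : ∀ x → -1ℤ ℤ.* (-1ℤ ℤ.* x) ≡ x
  square-cancel x = trans (ℤ.-1*i≡-i _) (trans (cong -_ (ℤ.-1*i≡-i x)) (ℤ.neg-involutive x))

sgn-+-*2^ : ∀ j e m → e < 2 ^ j → sgn (e + m * 2 ^ j) ≡ sgn e ℤ.* sgn m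
sgn-+-*2^ j e m e<2^j = begin
  sgn (e + m * 2 ^ j)               ≡⟨ sgn-parity (σ (e + m * 2 ^ j)) ⟩
  -1ℤ ℤ.^ σ (e + m * 2 ^ j)         ≡⟨ cong (-1ℤ ℤ.^_) (σ-+-*2^ j e m e<2^j) ⟩
  -1ℤ ℤ.^ (σ e + σ m)               ≡⟨ ℤ.^-distribˡ-+-* -1ℤ (σ e) (σ m) ⟩
  -1ℤ ℤ.^ σ e ℤ.* -1ℤ ℤ.^ σ m       ≡⟨ cong₂ ℤ._*_ (sgn-parity (σ e)) (sgn-parity (σ m)) ⟨
  sgn e ℤ.* sgn m                   ∎
  where open ≡-Reasoning

∣*sgn∣≡∣∣ : ∀ x k → ∣ x ℤ.* sgn k ∣ ≡ ∣ x ∣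
∣*sgn∣≡∣∣ x k = trans (ℤ.abs-* x (sgn k)) (trans (cong (∣ x ∣ *_) ∣sgn∣≡1) (*-identityʳ ∣ x ∣))
  where
  ∣sgn∣≡1 : ∣ sgn k ∣ ≡ 1
  ∣sgn∣≡1 with does (σ k % 2 ≟ 0)
  ... | true  = refl
  ... | false = refl

-- Finite sums Σ_{k<n} f(k)

Σ< : ℕ → (ℕ → ℤ) → ℤ
Σ< zero    f = + 0
Σ< (suc n) f = Σ< n f ℤ.+ f n

Σ<-cong : ∀ n {f g} → (∀ k → k < n → f k ≡ g k) → Σ< n f ≡ Σ< n g
Σ<-cong zero    f≗g = refl
Σ<-cong (suc n) f≗g = cong₂ ℤ._+_ (Σ<-cong n (λ k k<n → f≗g k (m<n⇒m<1+n k<n))) (f≗g n ≤-refl)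

Σ<-split : ∀ a b f → Σ< (a + b) f ≡ Σ< a f ℤ.+ Σ< b (λ e → f (a + e))
Σ<-split a zero    f = trans (cong (λ n → Σ< n f) (+-identityʳ a)) (sym (ℤ.+-identityʳ _))
Σ<-split a (suc b) f = begin
  Σ< (a + suc b) f                                   ≡⟨ cong (λ n → Σ< n f) (+-suc a b) ⟩
  Σ< (a + b) f ℤ.+ f (a + b)                         ≡⟨ cong (ℤ._+ f (a + b)) (Σ<-split a b f) ⟩
  Σ< a f ℤ.+ Σ< b (λ e → f (a + e)) ℤ.+ f (a + b)     ≡⟨ ℤ.+-assoc (Σ< a f) _ _ ⟩
  Σ< a f ℤ.+ Σ< (suc b) (λ e → f (a + e))            ∎
  where open ≡-Reasoning

Σ<-blocks : ∀ B q f → Σ< (q * B) f ≡ Σ< q (λ m → Σ< B (λ e → f (e + m * B)))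
Σ<-blocks B zero    f = refl
Σ<-blocks B (suc q) f = begin
  Σ< (B + q * B) f                                              ≡⟨ cong (λ n → Σ< n f) (+-comm B (q * B)) ⟩
  Σ< (q * B + B) f                                              ≡⟨ Σ<-split (q * B) B f ⟩
  Σ< (q * B) f ℤ.+ Σ< B (λ e → f (q * B + e))                   ≡⟨ cong₂ ℤ._+_ (Σ<-blocks B q f) last-block ⟩
  Σ< (suc q) (λ m → Σ< B (λ e → f (e + m * B)))                 ∎
  where
  open ≡-Reasoning
  last-block : Σ< B (λ e → f (q * B + e)) ≡ Σ< B (λ e → f (e + q * B))
  last-block = Σ<-cong B (λ e _ → cong f (+-comm (q * B) e))

Σ<-0 : ∀ n → Σ< n (λ _ → + 0) ≡ + 0
Σ<-0 zero    = refl
Σ<-0 (suc n) = cong (ℤ._+ + 0) (Σ<-0 n)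

Σ<-+ : ∀ n f g → Σ< n (λ k → f k ℤ.+ g k) ≡ Σ< n f ℤ.+ Σ< n g
Σ<-+ zero    f g = refl
Σ<-+ (suc n) f g = trans (cong (ℤ._+ (f n ℤ.+ g n)) (Σ<-+ n f g)) (interchange (Σ< n f) (Σ< n g) (f n) (g n))
  where
  interchange : ∀ a b c d → a ℤ.+ b ℤ.+ (c ℤ.+ d) ≡ a ℤ.+ c ℤ.+ (b ℤ.+ d)
  interchange = ℤ-Solver.solve-∀

Σ<-- : ∀ n f g → Σ< n (λ k → f k ℤ.- g k) ≡ Σ< n f ℤ.- Σ< n g
Σ<-- zero    f g = refl
Σ<-- (suc n) f g = trans (cong (ℤ._+ (f n ℤ.- g n)) (Σ<-- n f g)) (interchange (Σ< n f) (Σ< n g) (f n) (g n))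
  where
  interchange : ∀ a b c d → a ℤ.- b ℤ.+ (c ℤ.- d) ≡ a ℤ.+ c ℤ.- (b ℤ.+ d)
  interchange = ℤ-Solver.solve-∀

Σ<-* : ∀ n c f → Σ< n (λ k → c ℤ.* f k) ≡ c ℤ.* Σ< n f
Σ<-* zero    c f = sym (ℤ.*-zeroʳ c)
Σ<-* (suc n) c f = trans (cong (ℤ._+ c ℤ.* f n) (Σ<-* n c f)) (sym (ℤ.*-distribˡ-+ c (Σ< n f) (f n)))

∣Σ<∣≤ : ∀ n f → (∀ k → ∣ f k ∣ ≤ 1) → ∣ Σ< n f ∣ ≤ n
∣Σ<∣≤ zero    f ∣f∣≤1 = z≤n
∣Σ<∣≤ (suc n) f ∣f∣≤1 = begin
  ∣ Σ< n f ℤ.+ f n ∣         ≤⟨ ℤ.∣i+j∣≤∣i∣+∣j∣ (Σ< n f) (f n) ⟩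
  ∣ Σ< n f ∣ + ∣ f n ∣        ≤⟨ +-mono-≤ (∣Σ<∣≤ n f ∣f∣≤1) (∣f∣≤1 n) ⟩
  n + 1                      ≡⟨ +-comm n 1 ⟩
  suc n                      ∎
  where open ≤-Reasoning

-- Twisted sums Σ_{k<n} w(k) t(k)

twisted : (ℕ → ℤ) → ℕ → ℤ
twisted w n = Σ< n (λ k → w k ℤ.* sgn k)

twisted-cong : ∀ n {v w} → (∀ m → v m ≡ w m) → twisted v n ≡ twisted w n
twisted-cong n v≗w = Σ<-cong n (λ m _ → cong (ℤ._* sgn m) (v≗w m))

twisted-blocks : ∀ j w q →
  twisted w (q * 2 ^ j) ≡ twisted (λ m → Σ< (2 ^ j) (λ e → w (e + m * 2 ^ j) ℤ.* sgn e)) q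
twisted-blocks j w q = begin
  twisted w (q * B)                                                   ≡⟨ Σ<-blocks B q _ ⟩
  Σ< q (λ m → Σ< B (λ e → w (e + m * B) ℤ.* sgn (e + m * B)))         ≡⟨ Σ<-cong q (λ m _ → per-block m) ⟩
  twisted (λ m → Σ< B (λ e → w (e + m * B) ℤ.* sgn e)) q              ∎
  where
  open ≡-Reasoning
  B = 2 ^ j
  rearrange : ∀ a b c → a ℤ.* (b ℤ.* c) ≡ c ℤ.* (a ℤ.* b)
  rearrange = ℤ-Solver.solve-∀
  per-block : ∀ m → Σ< B (λ e → w (e + m * B) ℤ.* sgn (e + m * B)) ≡ Σ< B (λ e → w (e + m * B) ℤ.* sgn e) ℤ.* sgn m
  per-block m = begin
    Σ< B (λ e → w (e + m * B) ℤ.* sgn (e + m * B))   ≡⟨ Σ<-cong B (λ e e<B → trans (cong (w (e + m * B) ℤ.*_) (sgn-+-*2^ j e m e<B)) (rearrange (w (e + m * B)) (sgn e) (sgn m))) ⟩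
    Σ< B (λ e → sgn m ℤ.* (w (e + m * B) ℤ.* sgn e)) ≡⟨ Σ<-* B (sgn m) _ ⟩
    sgn m ℤ.* Σ< B (λ e → w (e + m * B) ℤ.* sgn e)   ≡⟨ ℤ.*-comm (sgn m) _ ⟩
    Σ< B (λ e → w (e + m * B) ℤ.* sgn e) ℤ.* sgn m   ∎

twisted-+ : ∀ n v w → twisted (λ m → v m ℤ.+ w m) n ≡ twisted v n ℤ.+ twisted w n
twisted-+ n v w = trans (Σ<-cong n (λ m _ → ℤ.*-distribʳ-+ (sgn m) (v m) (w m))) (Σ<-+ n _ _)

twisted-- : ∀ n v w → twisted (λ m → v m ℤ.- w m) n ≡ twisted v n ℤ.- twisted w n
twisted-- n v w = trans (Σ<-cong n (λ m _ → distrib (v m) (w m) (sgn m))) (Σ<-- n _ _)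
  where
  distrib : ∀ a b s → (a ℤ.- b) ℤ.* s ≡ a ℤ.* s ℤ.- b ℤ.* s
  distrib = ℤ-Solver.solve-∀

twisted-* : ∀ n c w → twisted (λ m → c ℤ.* w m) n ≡ c ℤ.* twisted w n
twisted-* n c w = trans (Σ<-cong n (λ m _ → ℤ.*-assoc c (w m) (sgn m))) (Σ<-* n c _)

∣w*sgn∣≤1 : ∀ (w : ℕ → ℤ) → (∀ k → ∣ w k ∣ ≤ 1) → ∀ k → ∣ w k ℤ.* sgn k ∣ ≤ 1
∣w*sgn∣≤1 w ∣w∣≤1 k = ≤-trans (≤-reflexive (∣*sgn∣≡∣∣ (w k) k)) (∣w∣≤1 k)

∣twisted∣≤n : ∀ (w : ℕ → ℤ) → (∀ k → ∣ w k ∣ ≤ 1) → ∀ n → ∣ twisted w n ∣ ≤ n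
∣twisted∣≤n w ∣w∣≤1 n = ∣Σ<∣≤ n _ (∣w*sgn∣≤1 w ∣w∣≤1)

∣twisted∣≤∣twisted-whole-blocks∣+n%B : ∀ (w : ℕ → ℤ) → (∀ k → ∣ w k ∣ ≤ 1) → ∀ B .{{_ : NonZero B}} n →
  ∣ twisted w n ∣ ≤ ∣ twisted w (n / B * B) ∣ + n % B
∣twisted∣≤∣twisted-whole-blocks∣+n%B w ∣w∣≤1 B n = begin
  ∣ twisted w n ∣                          ≡⟨ cong (λ x → ∣ twisted w x ∣) n≡q*B+r ⟩
  ∣ twisted w (q * B + n % B) ∣            ≡⟨ cong ∣_∣ (Σ<-split (q * B) (n % B) _) ⟩
  ∣ twisted w (q * B) ℤ.+ tail ∣           ≤⟨ ℤ.∣i+j∣≤∣i∣+∣j∣ (twisted w (q * B)) tail ⟩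
  ∣ twisted w (q * B) ∣ + ∣ tail ∣          ≤⟨ +-monoʳ-≤ ∣ twisted w (q * B) ∣ (∣Σ<∣≤ (n % B) _ (λ e → ∣w*sgn∣≤1 w ∣w∣≤1 (q * B + e))) ⟩
  ∣ twisted w (q * B) ∣ + n % B             ∎
  where
  open ≤-Reasoning
  q = n / B
  tail = Σ< (n % B) (λ e → w (q * B + e) ℤ.* sgn (q * B + e))
  n≡q*B+r : n ≡ q * B + n % B
  n≡q*B+r = trans (m≡m%n+[m/n]*n n B) (+-comm (n % B) _)

-- Sums over the multiples of d

isZero : ℕ → ℤ
isZero zero    = + 1
isZero (suc _) = + 0

χ : (d : ℕ) .{{_ : NonZero d}} → ℕ → ℤ
χ d k = isZero (k % d)

S : (d : ℕ) .{{_ : NonZero d}} → ℕ → ℤ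
S d = twisted (χ d)

blockWeight : (d : ℕ) .{{_ : NonZero d}} → ℕ → ℕ → ℤ
blockWeight d B t = Σ< B (λ e → χ d (e + t) ℤ.* sgn e)

∣χ∣≤1 : ∀ d .{{_ : NonZero d}} k → ∣ χ d k ∣ ≤ 1
∣χ∣≤1 d k with k % d
... | zero  = ≤-refl
... | suc _ = z≤n

χ-shift : ∀ d .{{_ : NonZero d}} B e m → B % d ≡ 1 % d → χ d (e + m * B) ≡ χ d (e + m % d)
χ-shift d B e m B%d≡1%d = cong isZero (begin
  (e + m * B) % d                  ≡⟨ %-distribˡ-+ e (m * B) d ⟩
  (e % d + (m * B) % d) % d        ≡⟨ cong (λ x → (e % d + x) % d) m*B%d≡m%d ⟩
  (e % d + m % d) % d              ≡⟨ cong (λ x → (e % d + x) % d) (m%n%n≡m%n m d) ⟨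
  (e % d + m % d % d) % d          ≡⟨ %-distribˡ-+ e (m % d) d ⟨
  (e + m % d) % d                  ∎)
  where
  open ≡-Reasoning
  m*B%d≡m%d : (m * B) % d ≡ m % d
  m*B%d≡m%d = begin
    (m * B) % d              ≡⟨ %-distribˡ-* m B d ⟩
    (m % d * (B % d)) % d    ≡⟨ cong (λ x → (m % d * x) % d) B%d≡1%d ⟩
    (m % d * (1 % d)) % d    ≡⟨ %-distribˡ-* m 1 d ⟨
    (m * 1) % d              ≡⟨ cong (_% d) (*-identityʳ m) ⟩
    m % d                    ∎

χ-mod : ∀ d D .{{_ : NonZero d}} .{{_ : NonZero D}} → d ∣ D → ∀ m → χ d (m % D) ≡ χ d m
χ-mod d D d∣D m = cong isZero (m∣n⇒o%n%m≡o%m d D m d∣D)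

S-blocks : ∀ d .{{_ : NonZero d}} j (c : ℕ → ℤ) → 2 ^ j % d ≡ 1 % d →
  (∀ {t} → t < d → blockWeight d (2 ^ j) t ≡ c t) →
  ∀ q → S d (q * 2 ^ j) ≡ twisted (λ m → c (m % d)) q
S-blocks d j c 2^j%d≡1%d block-weight q = trans (twisted-blocks j (χ d) q) (twisted-cong q reduce)
  where
  reduce : ∀ m → Σ< (2 ^ j) (λ e → χ d (e + m * 2 ^ j) ℤ.* sgn e) ≡ c (m % d)
  reduce m = trans (Σ<-cong (2 ^ j) (λ e _ → cong (ℤ._* sgn e) (χ-shift d (2 ^ j) e m 2^j%d≡1%d)))
                   (block-weight (m%n<n m d))

≡-below-by-computation : ∀ d (f g : ℕ → ℤ) → {True (allUpTo? (λ t → f t ℤ.≟ g t) d)} →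
  ∀ {t} → t < d → f t ≡ g t
≡-below-by-computation d f g {f≗g} = toWitness f≗g

block-weight₁ : ∀ {t} → t < 1 → blockWeight 1 2 t ≡ + 0
block-weight₁ = ≡-below-by-computation 1 (blockWeight 1 2) (λ _ → + 0)

block-weight₃ : ∀ {t} → t < 3 → blockWeight 3 4 t ≡ + 3 ℤ.* χ 3 t ℤ.- χ 1 t
block-weight₃ = ≡-below-by-computation 3 (blockWeight 3 4) (λ t → + 3 ℤ.* χ 3 t ℤ.- χ 1 t)

block-weight₉ : ∀ {t} → t < 9 → blockWeight 9 64 t ≡ + 3 ℤ.* χ 9 t ℤ.+ + 8 ℤ.* χ 3 t ℤ.- + 3 ℤ.* χ 1 t
block-weight₉ = ≡-below-by-computation 9 (blockWeight 9 64) (λ t → + 3 ℤ.* χ 9 t ℤ.+ + 8 ℤ.* χ 3 t ℤ.- + 3 ℤ.* χ 1 t)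

S₁-*2 : ∀ q → S 1 (q * 2) ≡ + 0
S₁-*2 q = trans (S-blocks 1 1 (λ _ → + 0) refl block-weight₁ q) (Σ<-0 q)

S₃-*4 : ∀ q → S 3 (q * 4) ≡ + 3 ℤ.* S 3 q ℤ.- S 1 q
S₃-*4 q = begin
  S 3 (q * 4)                                                 ≡⟨ S-blocks 3 2 _ refl block-weight₃ q ⟩
  twisted (λ m → + 3 ℤ.* χ 3 (m % 3) ℤ.- χ 1 (m % 3)) q       ≡⟨ twisted-cong q (λ m → cong₂ (λ a b → + 3 ℤ.* a ℤ.- b) (χ-mod 3 3 ∣-refl m) (χ-mod 1 3 (1∣ 3) m)) ⟩
  twisted (λ m → + 3 ℤ.* χ 3 m ℤ.- χ 1 m) q                   ≡⟨ twisted-- q (λ m → + 3 ℤ.* χ 3 m) (χ 1) ⟩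
  twisted (λ m → + 3 ℤ.* χ 3 m) q ℤ.- S 1 q                   ≡⟨ cong (ℤ._- S 1 q) (twisted-* q (+ 3) (χ 3)) ⟩
  + 3 ℤ.* S 3 q ℤ.- S 1 q                                     ∎
  where open ≡-Reasoning

S₉-*64 : ∀ q → S 9 (q * 64) ≡ + 3 ℤ.* S 9 q ℤ.+ + 8 ℤ.* S 3 q ℤ.- + 3 ℤ.* S 1 q
S₉-*64 q = begin
  S 9 (q * 64)                                                            ≡⟨ S-blocks 9 6 _ refl block-weight₉ q ⟩
  twisted (λ m → + 3 ℤ.* χ 9 (m % 9) ℤ.+ + 8 ℤ.* χ 3 (m % 9) ℤ.- + 3 ℤ.* χ 1 (m % 9)) q
    ≡⟨ twisted-cong q (λ m → cong₃ (χ-mod 9 9 ∣-refl m) (χ-mod 3 9 (divides 3 refl) m) (χ-mod 1 9 (1∣ 9) m)) ⟩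
  twisted (λ m → + 3 ℤ.* χ 9 m ℤ.+ + 8 ℤ.* χ 3 m ℤ.- + 3 ℤ.* χ 1 m) q
    ≡⟨ twisted-- q (λ m → + 3 ℤ.* χ 9 m ℤ.+ + 8 ℤ.* χ 3 m) (λ m → + 3 ℤ.* χ 1 m) ⟩
  twisted (λ m → + 3 ℤ.* χ 9 m ℤ.+ + 8 ℤ.* χ 3 m) q ℤ.- twisted (λ m → + 3 ℤ.* χ 1 m) q
    ≡⟨ cong₂ ℤ._-_ (twisted-+ q (λ m → + 3 ℤ.* χ 9 m) (λ m → + 8 ℤ.* χ 3 m)) (twisted-* q (+ 3) (χ 1)) ⟩
  twisted (λ m → + 3 ℤ.* χ 9 m) q ℤ.+ twisted (λ m → + 8 ℤ.* χ 3 m) q ℤ.- + 3 ℤ.* S 1 q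
    ≡⟨ cong (ℤ._- + 3 ℤ.* S 1 q) (cong₂ ℤ._+_ (twisted-* q (+ 3) (χ 9)) (twisted-* q (+ 8) (χ 3))) ⟩
  + 3 ℤ.* S 9 q ℤ.+ + 8 ℤ.* S 3 q ℤ.- + 3 ℤ.* S 1 q                        ∎
  where
  open ≡-Reasoning
  cong₃ : ∀ {a a′ b b′ c c′} → a ≡ a′ → b ≡ b′ → c ≡ c′ →
    + 3 ℤ.* a ℤ.+ + 8 ℤ.* b ℤ.- + 3 ℤ.* c ≡ + 3 ℤ.* a′ ℤ.+ + 8 ℤ.* b′ ℤ.- + 3 ℤ.* c′
  cong₃ refl refl refl = refl

-- Growth bounds

∣S₁∣≤1 : ∀ n → ∣ S 1 n ∣ ≤ 1
∣S₁∣≤1 n = begin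
  ∣ S 1 n ∣                   ≤⟨ ∣twisted∣≤∣twisted-whole-blocks∣+n%B (χ 1) (∣χ∣≤1 1) 2 n ⟩
  ∣ S 1 (n / 2 * 2) ∣ + n % 2  ≡⟨ cong (λ x → ∣ x ∣ + n % 2) (S₁-*2 (n / 2)) ⟩
  n % 2                       ≤⟨ ≤-pred (m%n<n n 2) ⟩
  1                           ∎
  where open ≤-Reasoning

∣S₃∣≤3∣S₃[n/4]∣+4 : ∀ n → ∣ S 3 n ∣ ≤ 3 * ∣ S 3 (n / 4) ∣ + 4
∣S₃∣≤3∣S₃[n/4]∣+4 n = begin
  ∣ S 3 n ∣                             ≤⟨ ∣twisted∣≤∣twisted-whole-blocks∣+n%B (χ 3) (∣χ∣≤1 3) 4 n ⟩
  ∣ S 3 (q * 4) ∣ + n % 4               ≤⟨ +-mono-≤ (≤-reflexive (cong ∣_∣ (S₃-*4 q))) (≤-pred (m%n<n n 4)) ⟩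
  ∣ + 3 ℤ.* S 3 q ℤ.- S 1 q ∣ + 3        ≤⟨ +-monoˡ-≤ 3 (ℤ.∣i-j∣≤∣i∣+∣j∣ (+ 3 ℤ.* S 3 q) (S 1 q)) ⟩
  ∣ + 3 ℤ.* S 3 q ∣ + ∣ S 1 q ∣ + 3       ≤⟨ +-monoˡ-≤ 3 (+-mono-≤ (≤-reflexive (ℤ.abs-* (+ 3) (S 3 q))) (∣S₁∣≤1 q)) ⟩
  3 * ∣ S 3 q ∣ + 1 + 3                  ≡⟨ +-assoc (3 * ∣ S 3 q ∣) 1 3 ⟩
  3 * ∣ S 3 q ∣ + 4                      ∎
  where
  open ≤-Reasoning
  q = n / 4

∣S₉∣≤3∣S₉[n/64]∣+8∣S₃[n/64]∣+66 : ∀ n → ∣ S 9 n ∣ ≤ 3 * ∣ S 9 (n / 64) ∣ + 8 * ∣ S 3 (n / 64) ∣ + 66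
∣S₉∣≤3∣S₉[n/64]∣+8∣S₃[n/64]∣+66 n = begin
  ∣ S 9 n ∣                                                    ≤⟨ ∣twisted∣≤∣twisted-whole-blocks∣+n%B (χ 9) (∣χ∣≤1 9) 64 n ⟩
  ∣ S 9 (q * 64) ∣ + n % 64                                    ≤⟨ +-mono-≤ (≤-reflexive (cong ∣_∣ (S₉-*64 q))) (≤-pred (m%n<n n 64)) ⟩
  ∣ a ℤ.+ b ℤ.- c ∣ + 63                                        ≤⟨ +-monoˡ-≤ 63 (ℤ.∣i-j∣≤∣i∣+∣j∣ (a ℤ.+ b) c) ⟩
  ∣ a ℤ.+ b ∣ + ∣ c ∣ + 63                                       ≤⟨ +-monoˡ-≤ 63 (+-monoˡ-≤ ∣ c ∣ (ℤ.∣i+j∣≤∣i∣+∣j∣ a b)) ⟩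
  ∣ a ∣ + ∣ b ∣ + ∣ c ∣ + 63                                      ≡⟨ cong₂ (λ x y → x + ∣ b ∣ + y + 63) (ℤ.abs-* (+ 3) (S 9 q)) (ℤ.abs-* (+ 3) (S 1 q)) ⟩
  3 * ∣ S 9 q ∣ + ∣ b ∣ + 3 * ∣ S 1 q ∣ + 63                      ≤⟨ +-monoˡ-≤ 63 (+-mono-≤ (+-monoʳ-≤ (3 * ∣ S 9 q ∣) (≤-reflexive (ℤ.abs-* (+ 8) (S 3 q)))) (*-monoʳ-≤ 3 (∣S₁∣≤1 q))) ⟩
  3 * ∣ S 9 q ∣ + 8 * ∣ S 3 q ∣ + 3 * 1 + 63                      ≡⟨ +-assoc (3 * ∣ S 9 q ∣ + 8 * ∣ S 3 q ∣) 3 63 ⟩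
  3 * ∣ S 9 q ∣ + 8 * ∣ S 3 q ∣ + 66                             ∎
  where
  open ≤-Reasoning
  q = n / 64
  a = + 3 ℤ.* S 9 q
  b = + 8 ℤ.* S 3 q
  c = + 3 ℤ.* S 1 q

∣S₃∣+2≤2*3^k : ∀ k n → n < 4 ^ k → ∣ S 3 n ∣ + 2 ≤ 2 * 3 ^ k
∣S₃∣+2≤2*3^k zero    zero    _         = ≤-refl
∣S₃∣+2≤2*3^k zero    (suc n) (s≤s ())
∣S₃∣+2≤2*3^k (suc k) n       n<4^[1+k] = begin
  ∣ S 3 n ∣ + 2                     ≤⟨ +-monoˡ-≤ 2 (∣S₃∣≤3∣S₃[n/4]∣+4 n) ⟩
  3 * ∣ S 3 (n / 4) ∣ + 4 + 2        ≡⟨ regroup ∣ S 3 (n / 4) ∣ ⟩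
  3 * (∣ S 3 (n / 4) ∣ + 2)          ≤⟨ *-monoʳ-≤ 3 (∣S₃∣+2≤2*3^k k (n / 4) n/4<4^k) ⟩
  3 * (2 * 3 ^ k)                   ≡⟨ swap (3 ^ k) ⟩
  2 * 3 ^ suc k                     ∎
  where
  open ≤-Reasoning
  n/4<4^k : n / 4 < 4 ^ k
  n/4<4^k = m<n*o⇒m/o<n (subst (n <_) (*-comm 4 (4 ^ k)) n<4^[1+k])
  regroup : ∀ r → 3 * r + 4 + 2 ≡ 3 * (r + 2)
  regroup = solve-∀
  swap : ∀ x → 3 * (2 * x) ≡ 2 * (3 * x)
  swap = solve-∀

∣S₉∣≤6*3^k : ∀ k n → n < 4 ^ k → ∣ S 9 n ∣ ≤ 6 * 3 ^ k
∣S₉∣≤6*3^k 0 n n<1  = ≤-trans (∣twisted∣≤n (χ 9) (∣χ∣≤1 9) n) (≤-trans (<⇒≤ n<1) (≤ᵇ⇒≤ 1 6 _))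
∣S₉∣≤6*3^k 1 n n<4  = ≤-trans (∣twisted∣≤n (χ 9) (∣χ∣≤1 9) n) (≤-trans (<⇒≤ n<4) (≤ᵇ⇒≤ 4 18 _))
∣S₉∣≤6*3^k 2 n n<16 = ≤-trans (∣twisted∣≤n (χ 9) (∣χ∣≤1 9) n) (≤-trans (<⇒≤ n<16) (≤ᵇ⇒≤ 16 54 _))
∣S₉∣≤6*3^k (suc (suc (suc k))) n n<4^[3+k] = begin
  ∣ S 9 n ∣                                  ≤⟨ ∣S₉∣≤3∣S₉[n/64]∣+8∣S₃[n/64]∣+66 n ⟩
  3 * ∣ S 9 q ∣ + 8 * ∣ S 3 q ∣ + 66          ≤⟨ +-monoˡ-≤ 66 (+-mono-≤ (*-monoʳ-≤ 3 (∣S₉∣≤6*3^k k q q<4^k)) (*-monoʳ-≤ 8 ∣S₃q∣≤2*3^k)) ⟩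
  3 * (6 * 3 ^ k) + 8 * (2 * 3 ^ k) + 66     ≤⟨ absorb-constant (3 ^ k) (m^n>0 3 k) ⟩
  6 * 3 ^ (3 + k)                            ∎
  where
  open ≤-Reasoning
  q = n / 64
  reassociate : ∀ y → 4 * (4 * (4 * y)) ≡ y * 64
  reassociate = solve-∀
  q<4^k : q < 4 ^ k
  q<4^k = m<n*o⇒m/o<n (subst (n <_) (reassociate (4 ^ k)) n<4^[3+k])
  ∣S₃q∣≤2*3^k : ∣ S 3 q ∣ ≤ 2 * 3 ^ k
  ∣S₃q∣≤2*3^k = m+n≤o⇒m≤o ∣ S 3 q ∣ (∣S₃∣+2≤2*3^k k q q<4^k)
  absorb-constant : ∀ y → 1 ≤ y → 3 * (6 * y) + 8 * (2 * y) + 66 ≤ 6 * (3 * (3 * (3 * y)))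
  absorb-constant (suc y) _ = ≤-trans (m≤m+n _ (128 * y + 62)) (≤-reflexive (identity y))
    where
    identity : ∀ y → 3 * (6 * suc y) + 8 * (2 * suc y) + 66 + (128 * y + 62) ≡ 6 * (3 * (3 * (3 * suc y)))
    identity = solve-∀

S90≡S₉ : ∀ n → S90 n ≡ S 9 n
S90≡S₉ zero    = refl
S90≡S₉ (suc n) = cong₂ ℤ._+_ (S90≡S₉ n) (indicator n)
  where
  indicator : ∀ x → (if does (9 ∣? x) then sgn x else + 0) ≡ χ 9 x ℤ.* sgn x
  indicator x with x % 9
  ... | zero  = sym (ℤ.*-identityˡ (sgn x))
  ... | suc _ = refl

mainTheorem7 : ∃ λ (C : ℕ) → ∀ (k n : ℕ) → 4 ^ k ≤ n → n < 4 ^ (k Data.Nat.+ 1) →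
                   ∣ S90 n ∣ ≤ C * 3 ^ k
mainTheorem7 = 18 , bound
  where
  bound : ∀ k n → 4 ^ k ≤ n → n < 4 ^ (k + 1) → ∣ S90 n ∣ ≤ 18 * 3 ^ k
  bound k n _ n<4^[k+1] = begin
    ∣ S90 n ∣            ≡⟨ cong ∣_∣ (S90≡S₉ n) ⟩
    ∣ S 9 n ∣            ≤⟨ ∣S₉∣≤6*3^k (k + 1) n n<4^[k+1] ⟩
    6 * 3 ^ (k + 1)      ≡⟨ cong (λ i → 6 * 3 ^ i) (+-comm k 1) ⟩
    6 * (3 * 3 ^ k)      ≡⟨ *-assoc 6 3 (3 ^ k) ⟨
    18 * 3 ^ k           ∎
    where open ≤-Reasoning
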